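{- Consider an instance of the Bin Packing with Usage Cost problem with $m$ bins, bin $j$ having positive integer capacity $C_j$, fixed cost $f_j\ge 0$ and unit cost $c_j\ge 0$, $C_{max}=\max_j C_j$, and items whose distinct sizes are the positive integers $w'_1,\dots,w'_{n'}$ with $q_d$ items of size $w'_d$. Let $z_2^*$ be the optimal value of the linear relaxation (replacing $p_{ij}\in\{0,1\}$ by $p_{ij}\ge 0$) of the cutting stock model $$\min \sum_{j=1}^m\sum_{i\in I_j} co_{ij}p_{ij}\quad\text{s.t.}\quad \sum_{j=1}^m\sum_{i\in I_j} g_{dij}p_{ij}=q_d\ \ \forall d\in\{1,\dots,n'\},\qquad \sum_{i\in I_j}p_{ij}=1\ \ \forall j\in\{1,\dots,m\},\qquad p_{ij}\in\{0,1\},$$ where $I_j$ indexes all patterns for bin $j$, i.e. all integer vectors $(g_{1ij},\dots,g_{n'ij})$ with $0\le g_{dij}\le q_d$ and $\sum_d g_{dij}w'_d\le C_j$, and $co_{ij}=f_j+c_j\sum_d g_{dij}w'_d$ for a non-empty pattern and $co_{ij}=0$ for the empty pattern. Let $z_3^*$ be the optimal value of the linear relaxation (replacing $x_{ab}\in\mathbb{N}$ by $x_{ab}\ge 0$ and $y_{aj}\in\{0,1\}$ by $0\le y_{aj}\le 1$) of the arc-flow model defined on the arc set $I=\{(a,a+w'_d): d\in\{1,\dots,n'\},\ a\ge 0,\ a+w'_d\le C_{max}\}$ on nodes $\{0,\dots,C_{max}\}$, with variables $x_{ab}$ for $(a,b)\in I$ and $y_{aj}$ for $j\in\{1,\dots,m\}$,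 $a\in\{0,\dots,C_{max}\}$: $$\min \sum_{j=1}^m\sum_{a=0}^{C_{max}} co_{aj}y_{aj},\quad co_{aj}=f_j+a c_j\ (a>0),\ co_{0j}=0,$$ subject to: for every $b\in\{1,\dots,C_{max}\}$, $\sum_{(a,b)\in I}x_{ab}-\sum_{(b,c)\in I}x_{bc}-\sum_{j=1}^m y_{bj}=0$; for $b=0$, $-\sum_{(0,c)\in I}x_{0c}-\sum_{j=1}^m y_{0j}=-m$; $\sum_{a=0}^{C_j}y_{aj}=1$ for all $j$; $\sum_{(a,a+w'_d)\in I}x_{a,a+w'_d}=q_d$ for all $d$; $y_{aj}=0$ for all $j$ and $a\in\{C_j+1,\dots,C_{max}\}$; $x_{ab}\in\mathbb{N}$; $y_{aj}\in\{0,1\}$. Then $z_3^*\le z_2^*$.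
   Context: The Bin Packing with Usage Cost problem: each item must be assigned to exactly one bin without exceeding capacities; a used bin $j$ with load $l_j$ costs $f_j+c_jl_j$, unused bins cost nothing; minimise total cost. In the arc-flow model, an arc $(a,a+w'_d)$ represents placing an item of size $w'_d$, and $y_{aj}$ represents bin $j$ being used up to load $a$ (an arc from node $a$ to a final node).
   Formalization: The fixed costs $f_j$ and unit costs $c_j$ of the bins, and the variables of both linear relaxations, are rational rather than real. -}

module Defs where

open import Data.Nat as ℕ using (ℕ; zero; suc; _⊔_; _≟_; _≤?_)
open import Data.Fin using (Fin; zero; suc)
open import Data.Bool using (Bool; true; false; _∧_; if_then_else_)
open import Data.Integer using (+_)
open import Data.Rational using (ℚ; 0ℚ; 1ℚ; _+_; _*_; _/_; -_; _-_; _≤_)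
open import Data.List using (List; []; _∷_; [_]; map; concatMap; upTo; allFin; filter; foldr)
open import Data.Vec using (Vec; []; _∷_; lookup)
open import Data.Product using (_×_; _,_; proj₁; proj₂; Σ)
open import Relation.Binary.PropositionalEquality using (_≡_)
open import Relation.Nullary.Decidable using (⌊_⌋)
open import Function using (_∘_)
import Data.List.Membership.Propositional

⟦_⟧ : ℕ → ℚ
⟦ n ⟧ = + n / 1

Σℚ : List ℚ → ℚ
Σℚ = foldr _+_ 0ℚ

Σℕ : List ℕ → ℕ
Σℕ = foldr ℕ._+_ 0

ΣFinℚ : (n : ℕ) → (Fin n → ℚ) → ℚ
ΣFinℚ n g = Σℚ (map g (allFin n))

Σ≤ℚ : ℕ → (ℕ → ℚ) → ℚ
Σ≤ℚ k g = Σℚ (map g (upTo (suc k)))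

-- An instance of Bin Packing with Usage Cost (data only; the
-- hypotheses on the data are stated in the theorem).
--   m bins, capacities C j, fixed costs f j, unit costs c j;
--   n' distinct item sizes w d, with q d items of size w d.

record Instance : Set where
  field
    m  : ℕ
    C  : Fin m → ℕ
    f  : Fin m → ℚ
    c  : Fin m → ℚ
    n' : ℕ
    w  : Fin n' → ℕ
    q  : Fin n' → ℕ

-- all integer vectors g with 0 ≤ g d ≤ b d (each exactly once)
allBounded : (k : ℕ) → (Fin k → ℕ) → List (Vec ℕ k)
allBounded zero    b = [ [] ]
allBounded (suc k) b =
  concatMap (λ g₀ → map (g₀ ∷_) (allBounded k (b ∘ suc))) (upTo (suc (b zero)))

allZero : ∀ {k} → Vec ℕ k → Bool
allZero []      = true
allZero (x ∷ g) = ⌊ x ≟ 0 ⌋ ∧ allZero g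

module _ (ins : Instance) where
  open Instance ins

  Cmax : ℕ
  Cmax = foldr _⊔_ 0 (map C (allFin m))

  load : Vec ℕ n' → ℕ
  load g = Σℕ (map (λ d → lookup g d ℕ.* w d) (allFin n'))

  patterns : Fin m → List (Vec ℕ n')
  patterns j = filter (λ g → load g ≤? C j) (allBounded n' q)

  patCost : Fin m → Vec ℕ n' → ℚ
  patCost j g = if allZero g then 0ℚ else (f j + c j * ⟦ load g ⟧)

  -- a solution assigns p_ij to each bin j and pattern i ∈ I_j
  Sol2 : Set
  Sol2 = Fin m → Vec ℕ n' → ℚ

  obj2 : Sol2 → ℚ
  obj2 p = ΣFinℚ m (λ j → Σℚ (map (λ g → patCost j g * p j g) (patterns j)))

  record Feasible2 (p : Sol2) : Set where
    field
      nonneg  : ∀ j g → g Data.List.Membership.Propositional.∈ patterns j → 0ℚ ≤ p j g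
      demand  : ∀ d → ΣFinℚ m (λ j → Σℚ (map (λ g → ⟦ lookup g d ⟧ * p j g) (patterns j))) ≡ ⟦ q d ⟧
      convex  : ∀ j → Σℚ (map (p j) (patterns j)) ≡ 1ℚ

  IsOptimalValue2 : ℚ → Set
  IsOptimalValue2 z = Σ Sol2 (λ p → Feasible2 p × obj2 p ≡ z)
                    × (∀ p → Feasible2 p → z ≤ obj2 p)

  arcsOf : Fin n' → List (ℕ × ℕ)
  arcsOf d = map (λ a → (a , a ℕ.+ w d)) (filter (λ a → (a ℕ.+ w d) ≤? Cmax) (upTo (suc Cmax)))

  arcs : List (ℕ × ℕ)
  arcs = concatMap arcsOf (allFin n')

  arcsInto : ℕ → List (ℕ × ℕ)
  arcsInto b = filter (λ e → proj₂ e ≟ b) arcs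

  arcsOutOf : ℕ → List (ℕ × ℕ)
  arcsOutOf b = filter (λ e → proj₁ e ≟ b) arcs

  arcCost : ℕ → Fin m → ℚ
  arcCost zero    j = 0ℚ
  arcCost (suc a) j = f j + ⟦ suc a ⟧ * c j

  record Sol3 : Set where
    field
      x : ℕ → ℕ → ℚ
      y : ℕ → Fin m → ℚ

  obj3 : Sol3 → ℚ
  obj3 s = ΣFinℚ m (λ j → Σ≤ℚ Cmax (λ a → arcCost a j * Sol3.y s a j))

  record Feasible3 (s : Sol3) : Set where
    open Sol3 s
    xin : ℕ → ℚ
    xin b = Σℚ (map (λ e → x (proj₁ e) (proj₂ e)) (arcsInto b))
    xout : ℕ → ℚ
    xout b = Σℚ (map (λ e → x (proj₁ e) (proj₂ e)) (arcsOutOf b))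
    field
      x-nonneg : ∀ a b → (a , b) Data.List.Membership.Propositional.∈ arcs → 0ℚ ≤ x a b
      y-nonneg : ∀ a j → a ℕ.≤ Cmax → 0ℚ ≤ y a j
      y-le1    : ∀ a j → a ℕ.≤ Cmax → y a j ≤ 1ℚ
      flow     : ∀ b → 1 ℕ.≤ b → b ℕ.≤ Cmax →
                 (xin b - xout b) - ΣFinℚ m (y b) ≡ 0ℚ
      flow0    : (- xout 0) - ΣFinℚ m (y 0) ≡ - ⟦ m ⟧
      assign   : ∀ j → Σ≤ℚ (C j) (λ a → y a j) ≡ 1ℚ
      demand   : ∀ d → Σℚ (map (λ e → x (proj₁ e) (proj₂ e)) (arcsOf d)) ≡ ⟦ q d ⟧
      y-zero   : ∀ j a → C j ℕ.< a → a ℕ.≤ Cmax → y a j ≡ 0ℚ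

  IsOptimalValue3 : ℚ → Set
  IsOptimalValue3 z = Σ Sol3 (λ s → Feasible3 s × obj3 s ≡ z)
                    × (∀ s → Feasible3 s → z ≤ obj3 s)

record ValidInstance (ins : Instance) : Set where
  open Instance ins
  field
    C-pos   : ∀ j → 1 ℕ.≤ C j
    f-nonneg : ∀ j → 0ℚ ≤ f j
    c-nonneg : ∀ j → 0ℚ ≤ c j
    w-pos   : ∀ d → 1 ℕ.≤ w d
    w-distinct : ∀ d d' → w d ≡ w d' → d ≡ d'
    q-pos   : ∀ d → 1 ℕ.≤ q d

module Submission where

-- Every feasible solution p of the linear relaxation of the cutting-stock
-- model (2) is translated into a feasible solution of the linear relaxation of
-- the arc-flow model (3) with the same objective value; for an optimal p this
-- gives z₃* ≤ obj₃ = obj₂(p) = z₂*.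
--
-- The translation lays out a pattern g (a multiset of item sizes) as a path
-- 0 → w_{d₁} → w_{d₁} + w_{d₂} → … → load g, one arc per item, and sets
--   x_ab = Σ_j Σ_{g ∈ I_j} p_jg · (number of arcs (a,b) on the path of g),
--   y_aj = Σ_{g ∈ I_j} p_jg · [load g = a].
-- Every constraint of (3) is linear in p, so it reduces to a fact about one
-- path: inflow + [start = b] = outflow + [end = b] at every node b; the path
-- uses exactly g_d arcs of size w_d; it ends at node load g ≤ C_j; and the
-- arc-flow cost co_{load g, j} of that end node is the pattern cost co_{gj}.

open import Defs
open import Data.Nat as ℕ using (ℕ; zero; suc; _≟_; _≤?_)
import Data.Nat.Properties as ℕP
import Data.Integer as ℤ
import Data.Integer.Properties as ℤP
open import Data.Nat.Coprimality as Coprime using (1-coprimeTo)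
open import Data.Rational using (ℚ; mkℚ; 0ℚ; 1ℚ; _+_; _*_; _-_; -_; _≤_; *≤*; nonNegative)
open import Data.Rational.Properties
  using ( normalize-coprime; /-cong; +-identityˡ; +-identityʳ; +-assoc; *-identityˡ; *-identityʳ
        ; *-zeroˡ; *-zeroʳ; *-comm; *-distribˡ-+; ≤-refl; ≤-trans; ≤-reflexive; +-mono-≤
        ; nonNegative⁻¹; nonNeg*nonNeg⇒nonNeg; *-monoˡ-≤-nonNeg; neg-distrib-+ )
open import Data.Rational.Solver using (module +-*-Solver)
open import Data.List using (List; []; _∷_; foldr; map; concatMap; upTo; allFin; filter; _++_; replicate; tabulate; length)
import Data.List.Properties as ListP
open import Data.List.Membership.Propositional using (_∈_)
open import Data.List.Membership.Propositional.Properties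
  using (∈-allFin; ∈-upTo⁺; ∈-map⁺; ∈-map⁻; ∈-filter⁺; ∈-filter⁻)
open import Data.List.Relation.Unary.Any using (here; there)
import Data.List.Relation.Unary.All as All
open import Data.List.Relation.Unary.AllPairs using (_∷_)
open import Data.List.Relation.Unary.Unique.Propositional using (Unique)
import Data.List.Relation.Unary.Unique.Propositional.Properties as Unique
open import Data.Fin using (Fin; zero; suc)
import Data.Fin.Properties as FinP
open import Data.Vec using (Vec; []; _∷_; lookup)
open import Data.Bool using (true; false)
open import Data.Product using (_×_; _,_; proj₁; proj₂)
import Data.Product.Properties as ProdP
open import Relation.Nullary using (Dec; yes; no; ¬_; contradiction)
open import Relation.Unary using (Pred; Decidable)
open import Relation.Binary.Definitions using (DecidableEquality)
open import Relation.Binary.PropositionalEquality using (_≡_; _≢_; refl; sym; trans; cong; cong₂; module ≡-Reasoning)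
open import Function using (_∘_)

open +-*-Solver using (solve; _:+_; _:*_; _:-_; _:=_; con)
open ≡-Reasoning

⟦⟧-asFraction : ∀ k → ⟦ k ⟧ ≡ mkℚ (ℤ.+ k) 0 (Coprime.sym (1-coprimeTo k))
⟦⟧-asFraction k = normalize-coprime (Coprime.sym (1-coprimeTo k))

⟦+⟧ : ∀ m n → ⟦ m ℕ.+ n ⟧ ≡ ⟦ m ⟧ + ⟦ n ⟧
⟦+⟧ m n rewrite ⟦⟧-asFraction m | ⟦⟧-asFraction n =
  /-cong {ℤ.+ (m ℕ.+ n)} {1} {(ℤ.+ m ℤ.* ℤ.+ 1) ℤ.+ (ℤ.+ n ℤ.* ℤ.+ 1)} {1 ℕ.* 1}
         (cong₂ ℤ._+_ (sym (ℤP.*-identityʳ (ℤ.+ m))) (sym (ℤP.*-identityʳ (ℤ.+ n)))) refl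

*-nonneg : ∀ {a b} → 0ℚ ≤ a → 0ℚ ≤ b → 0ℚ ≤ a * b
*-nonneg {a} {b} 0≤a 0≤b =
  nonNegative⁻¹ (a * b) {{nonNeg*nonNeg⇒nonNeg a {{nonNegative 0≤a}} b {{nonNegative 0≤b}}}}

∑ : {A : Set} → List A → (A → ℚ) → ℚ
∑ L f = Σℚ (map f L)

module _ {A : Set} where

  ∑-++ : (L M : List A) (f : A → ℚ) → ∑ (L ++ M) f ≡ ∑ L f + ∑ M f
  ∑-++ []      M f = sym (+-identityˡ _)
  ∑-++ (x ∷ L) M f rewrite ∑-++ L M f = sym (+-assoc (f x) (∑ L f) (∑ M f))

  ∑-cong∈ : (L : List A) {f g : A → ℚ} → (∀ {a} → a ∈ L → f a ≡ g a) → ∑ L f ≡ ∑ L g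
  ∑-cong∈ []      eq = refl
  ∑-cong∈ (x ∷ L) eq = cong₂ _+_ (eq (here refl)) (∑-cong∈ L (eq ∘ there))

  ∑-cong : (L : List A) {f g : A → ℚ} → (∀ a → f a ≡ g a) → ∑ L f ≡ ∑ L g
  ∑-cong L eq = ∑-cong∈ L (λ {a} _ → eq a)

  ∑-zero : (L : List A) → ∑ L (λ _ → 0ℚ) ≡ 0ℚ
  ∑-zero []      = refl
  ∑-zero (x ∷ L) rewrite ∑-zero L = refl

  ∑-vanish : (L : List A) (f : A → ℚ) → (∀ {a} → a ∈ L → f a ≡ 0ℚ) → ∑ L f ≡ 0ℚ
  ∑-vanish L f eq = trans (∑-cong∈ L eq) (∑-zero L)

  ∑-distrib-+ : (L : List A) (f g : A → ℚ) → ∑ L (λ a → f a + g a) ≡ ∑ L f + ∑ L g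
  ∑-distrib-+ []      f g = refl
  ∑-distrib-+ (x ∷ L) f g rewrite ∑-distrib-+ L f g =
    solve 4 (λ a b c d → (a :+ b) :+ (c :+ d) := (a :+ c) :+ (b :+ d)) refl (f x) (g x) (∑ L f) (∑ L g)

  ∑-scale : (L : List A) (k : ℚ) (f : A → ℚ) → ∑ L (λ a → k * f a) ≡ k * ∑ L f
  ∑-scale []      k f = sym (*-zeroʳ k)
  ∑-scale (x ∷ L) k f rewrite ∑-scale L k f = sym (*-distribˡ-+ k (f x) (∑ L f))

  ∑-nonneg : (L : List A) (f : A → ℚ) → (∀ {a} → a ∈ L → 0ℚ ≤ f a) → 0ℚ ≤ ∑ L f
  ∑-nonneg []      f h = ≤-refl
  ∑-nonneg (x ∷ L) f h = +-mono-≤ (h (here refl)) (∑-nonneg L f (h ∘ there))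

  ∑-mono : (L : List A) (f g : A → ℚ) → (∀ {a} → a ∈ L → f a ≤ g a) → ∑ L f ≤ ∑ L g
  ∑-mono []      f g h = ≤-refl
  ∑-mono (x ∷ L) f g h = +-mono-≤ (h (here refl)) (∑-mono L f g (h ∘ there))

  ∑-replicate : (k : ℕ) (x : A) (f : A → ℚ) → ∑ (replicate k x) f ≡ ⟦ k ⟧ * f x
  ∑-replicate zero    x f = sym (*-zeroˡ (f x))
  ∑-replicate (suc k) x f = begin
    f x + ∑ (replicate k x) f ≡⟨ cong (f x +_) (∑-replicate k x f) ⟩
    f x + ⟦ k ⟧ * f x         ≡⟨ solve 2 (λ v K → v :+ K :* v := (con 1ℚ :+ K) :* v) refl (f x) ⟦ k ⟧ ⟩
    (1ℚ + ⟦ k ⟧) * f x        ≡⟨ cong (_* f x) (sym (⟦+⟧ 1 k)) ⟩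
    ⟦ suc k ⟧ * f x           ∎

  ∑-length : (L : List A) → ∑ L (λ _ → 1ℚ) ≡ ⟦ length L ⟧
  ∑-length []      = refl
  ∑-length (x ∷ L) = trans (cong (1ℚ +_) (∑-length L)) (sym (⟦+⟧ 1 (length L)))

module _ {A B : Set} where

  ∑-swap : (L : List A) (M : List B) (F : A → B → ℚ) →
           ∑ L (λ a → ∑ M (F a)) ≡ ∑ M (λ b → ∑ L (λ a → F a b))
  ∑-swap []      M F = sym (∑-zero M)
  ∑-swap (x ∷ L) M F rewrite ∑-swap L M F = sym (∑-distrib-+ M (F x) (λ b → ∑ L (λ a → F a b)))

  ∑-concatMap : (h : A → List B) (L : List A) (f : B → ℚ) →
                ∑ (concatMap h L) f ≡ ∑ L (λ a → ∑ (h a) f)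
  ∑-concatMap h []      f = refl
  ∑-concatMap h (x ∷ L) f rewrite ∑-++ (h x) (concatMap h L) f | ∑-concatMap h L f = refl

𝟙 : {P : Set} → Dec P → ℚ
𝟙 (yes _) = 1ℚ
𝟙 (no _)  = 0ℚ

𝟙-nonneg : {P : Set} (P? : Dec P) → 0ℚ ≤ 𝟙 P?
𝟙-nonneg (yes _) = *≤* (ℤ.+≤+ ℕ.z≤n)
𝟙-nonneg (no _)  = ≤-refl

𝟙≤1 : {P : Set} (P? : Dec P) → 𝟙 P? ≤ 1ℚ
𝟙≤1 (yes _) = ≤-refl
𝟙≤1 (no _)  = *≤* (ℤ.+≤+ ℕ.z≤n)

𝟙-yes : {P : Set} (P? : Dec P) → P → 𝟙 P? ≡ 1ℚ
𝟙-yes (yes _) _ = refl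
𝟙-yes (no ¬p) p = contradiction p ¬p

𝟙-no : {P : Set} (P? : Dec P) → ¬ P → 𝟙 P? ≡ 0ℚ
𝟙-no (yes p) ¬p = contradiction p ¬p
𝟙-no (no _)  _  = refl

𝟙-cong : {P Q : Set} (P? : Dec P) (Q? : Dec Q) → (P → Q) → (Q → P) → 𝟙 P? ≡ 𝟙 Q?
𝟙-cong (yes p) Q? to from = sym (𝟙-yes Q? (to p))
𝟙-cong (no ¬p) Q? to from = sym (𝟙-no Q? (¬p ∘ from))

∑-filter : {A : Set} {P : Pred A _} (P? : Decidable P) (L : List A) (f : A → ℚ) →
           ∑ (filter P? L) f ≡ ∑ L (λ a → 𝟙 (P? a) * f a)
∑-filter P? []      f = refl
∑-filter P? (x ∷ L) f with P? x
... | yes _ = cong₂ _+_ (sym (*-identityˡ (f x))) (∑-filter P? L f)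
... | no _  = trans (∑-filter P? L f) (sym (trans (cong (_+ _) (*-zeroˡ (f x))) (+-identityˡ _)))

∑-point : {A : Set} (_≟A_ : DecidableEquality A) {L : List A} {l : A} (h : A → ℚ) →
          Unique L → l ∈ L → ∑ L (λ a → 𝟙 (l ≟A a) * h a) ≡ h l
∑-point _≟A_ {x ∷ L} h (x∉L ∷ _) (here refl) = begin
  𝟙 (x ≟A x) * h x + ∑ L (λ a → 𝟙 (x ≟A a) * h a)
    ≡⟨ cong₂ _+_ (cong (_* h x) (𝟙-yes (x ≟A x) refl)) (∑-vanish L _ off) ⟩
  1ℚ * h x + 0ℚ ≡⟨ trans (+-identityʳ _) (*-identityˡ (h x)) ⟩
  h x           ∎
  where
  off : ∀ {a} → a ∈ L → 𝟙 (x ≟A a) * h a ≡ 0ℚ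
  off {a} a∈L = trans (cong (_* h a) (𝟙-no (x ≟A a) (All.lookup x∉L a∈L))) (*-zeroˡ (h a))
∑-point _≟A_ {x ∷ L} {l} h (x∉L ∷ unique) (there l∈L) = begin
  𝟙 (l ≟A x) * h x + ∑ L (λ a → 𝟙 (l ≟A a) * h a)
    ≡⟨ cong₂ _+_ (cong (_* h x) (𝟙-no (l ≟A x) (All.lookup x∉L l∈L ∘ sym))) (∑-point _≟A_ h unique l∈L) ⟩
  0ℚ * h x + h l ≡⟨ trans (cong (_+ h l) (*-zeroˡ (h x))) (+-identityˡ (h l)) ⟩
  h l            ∎

-- Items of sizes w d are placed end to end starting at node s; item d placed
-- at node a occupies the arc from a to a + w d.

module ItemPaths {A : Set} (w : A → ℕ) where

  size : List A → ℕ
  size []       = 0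
  size (d ∷ ds) = w d ℕ.+ size ds

  size-++ : (ds es : List A) → size (ds ++ es) ≡ size ds ℕ.+ size es
  size-++ []       es = refl
  size-++ (d ∷ ds) es rewrite size-++ ds es = sym (ℕP.+-assoc (w d) (size ds) (size es))

  size-replicate : (k : ℕ) (d : A) → size (replicate k d) ≡ k ℕ.* w d
  size-replicate zero    d = refl
  size-replicate (suc k) d = cong (w d ℕ.+_) (size-replicate k d)

  size-concatMap : {B : Set} (h : B → List A) (L : List B) → size (concatMap h L) ≡ Σℕ (map (size ∘ h) L)
  size-concatMap h []      = refl
  size-concatMap h (x ∷ L) rewrite size-++ (h x) (concatMap h L) | size-concatMap h L = refl

  end : ℕ × A → ℕ
  end (a , d) = a ℕ.+ w d

  path : ℕ → List A → List (ℕ × A)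
  path s []       = []
  path s (d ∷ ds) = (s , d) ∷ path (s ℕ.+ w d) ds

  path-bounded : ∀ s ds {ad} → ad ∈ path s ds → end ad ℕ.≤ s ℕ.+ size ds
  path-bounded s (d ∷ ds) (here refl) = ℕP.+-monoʳ-≤ s (ℕP.m≤m+n (w d) (size ds))
  path-bounded s (d ∷ ds) (there i)   =
    ℕP.≤-trans (path-bounded (s ℕ.+ w d) ds i) (ℕP.≤-reflexive (ℕP.+-assoc s (w d) (size ds)))

  path-items : ∀ s ds (F : A → ℚ) → ∑ (path s ds) (F ∘ proj₂) ≡ ∑ ds F
  path-items s []       F = refl
  path-items s (d ∷ ds) F = cong (F d +_) (path-items (s ℕ.+ w d) ds F)

  path-conservation : ∀ s ds b →
    ∑ (path s ds) (λ ad → 𝟙 (end ad ≟ b)) + 𝟙 (s ≟ b)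
      ≡ ∑ (path s ds) (λ ad → 𝟙 (proj₁ ad ≟ b)) + 𝟙 (s ℕ.+ size ds ≟ b)
  path-conservation s [] b =
    cong (0ℚ +_) (𝟙-cong (s ≟ b) (s ℕ.+ 0 ≟ b) (trans (ℕP.+-identityʳ s)) (trans (sym (ℕP.+-identityʳ s))))
  path-conservation s (d ∷ ds) b = begin
    (𝟙 (s′ ≟ b) + In) + 𝟙 (s ≟ b)
      ≡⟨ solve 3 (λ e i o → (e :+ i) :+ o := o :+ (i :+ e)) refl (𝟙 (s′ ≟ b)) In (𝟙 (s ≟ b)) ⟩
    𝟙 (s ≟ b) + (In + 𝟙 (s′ ≟ b))
      ≡⟨ cong (𝟙 (s ≟ b) +_) (path-conservation s′ ds b) ⟩
    𝟙 (s ≟ b) + (Out + 𝟙 (s′ ℕ.+ size ds ≟ b))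
      ≡⟨ sym (+-assoc (𝟙 (s ≟ b)) Out _) ⟩
    (𝟙 (s ≟ b) + Out) + 𝟙 (s′ ℕ.+ size ds ≟ b)
      ≡⟨ cong ((𝟙 (s ≟ b) + Out) +_) (𝟙-cong (s′ ℕ.+ size ds ≟ b) (s ℕ.+ (w d ℕ.+ size ds) ≟ b)
                              (trans (sym (ℕP.+-assoc s (w d) (size ds))))
                              (trans (ℕP.+-assoc s (w d) (size ds)))) ⟩
    (𝟙 (s ≟ b) + Out) + 𝟙 (s ℕ.+ (w d ℕ.+ size ds) ≟ b) ∎
    where
    s′ : ℕ
    s′ = s ℕ.+ w d
    In Out : ℚ
    In  = ∑ (path s′ ds) (λ ad → 𝟙 (end ad ≟ b))
    Out = ∑ (path s′ ds) (λ ad → 𝟙 (proj₁ ad ≟ b))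

  path-source : (∀ d → 1 ℕ.≤ w d) → ∀ s ds → ∑ (path s ds) (λ ad → 𝟙 (end ad ≟ 0)) ≡ 0ℚ
  path-source w-pos s ds = ∑-vanish (path s ds) _ λ {ad} _ →
    𝟙-no (end ad ≟ 0) (λ eq → ℕP.<⇒≢ (w-pos (proj₂ ad)) (sym (ℕP.m+n≡0⇒n≡0 (proj₁ ad) eq)))

-- Σ_d v_d u_d, written with tabulate so that it unfolds along the vector v.
dot : ∀ {k} → Vec ℕ k → (Fin k → ℕ) → ℕ
dot v u = Σℕ (tabulate (λ d → lookup v d ℕ.* u d))

dot-allZero : ∀ {k} (v : Vec ℕ k) (u : Fin k → ℕ) → allZero v ≡ true → dot v u ≡ 0
dot-allZero []          u eq = refl
dot-allZero (zero ∷ v)  u eq = dot-allZero v (u ∘ suc) eq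

dot-nonzero : ∀ {k} (v : Vec ℕ k) (u : Fin k → ℕ) → (∀ d → 1 ℕ.≤ u d) →
              allZero v ≡ false → dot v u ≢ 0
dot-nonzero (zero ∷ v)  u u-pos eq = dot-nonzero v (u ∘ suc) (u-pos ∘ suc) eq
dot-nonzero (suc x ∷ v) u u-pos _  = ℕP.<⇒≢ (ℕP.*-mono-≤ (ℕ.s≤s (ℕ.z≤n {x})) (u-pos zero)) ∘ sym ∘ ℕP.m+n≡0⇒m≡0 _

module Patterns (ins : Instance) where
  open Instance ins
  open ItemPaths w

  items : Vec ℕ n' → List (Fin n')
  items g = concatMap (λ d → replicate (lookup g d) d) (allFin n')

  route : Vec ℕ n' → List (ℕ × Fin n')
  route g = path 0 (items g)

  load≡dot : ∀ g → load ins g ≡ dot g w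
  load≡dot g = cong Σℕ (ListP.map-tabulate (λ i → i) (λ d → lookup g d ℕ.* w d))

  size-items : ∀ g → size (items g) ≡ load ins g
  size-items g = trans (size-concatMap _ (allFin n'))
                       (cong Σℕ (ListP.map-cong (λ d → size-replicate (lookup g d) d) (allFin n')))

  count-items : ∀ g d′ → ∑ (items g) (λ d → 𝟙 (d FinP.≟ d′)) ≡ ⟦ lookup g d′ ⟧
  count-items g d′ = begin
    ∑ (items g) (λ d → 𝟙 (d FinP.≟ d′))
      ≡⟨ ∑-concatMap (λ d → replicate (lookup g d) d) (allFin n') _ ⟩
    ∑ (allFin n') (λ d → ∑ (replicate (lookup g d) d) (λ d → 𝟙 (d FinP.≟ d′)))
      ≡⟨ ∑-cong (allFin n') (λ d → trans (∑-replicate (lookup g d) d _) (reorder d)) ⟩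
    ∑ (allFin n') (λ d → 𝟙 (d′ FinP.≟ d) * ⟦ lookup g d ⟧)
      ≡⟨ ∑-point FinP._≟_ (λ d → ⟦ lookup g d ⟧) (Unique.allFin⁺ n') (∈-allFin d′) ⟩
    ⟦ lookup g d′ ⟧ ∎
    where
    reorder : ∀ d → ⟦ lookup g d ⟧ * 𝟙 (d FinP.≟ d′) ≡ 𝟙 (d′ FinP.≟ d) * ⟦ lookup g d ⟧
    reorder d = trans (*-comm ⟦ lookup g d ⟧ (𝟙 (d FinP.≟ d′))) (cong (_* ⟦ lookup g d ⟧) (𝟙-cong (d FinP.≟ d′) (d′ FinP.≟ d) sym sym))

  arcCost≡patCost : (∀ d → 1 ℕ.≤ w d) → ∀ j g → arcCost ins (load ins g) j ≡ patCost ins j g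
  arcCost≡patCost w-pos j g with allZero g in empty?
  ... | true  rewrite trans (load≡dot g) (dot-allZero g w empty?) = refl
  ... | false = nonzero (load ins g) (dot-nonzero g w w-pos empty? ∘ trans (sym (load≡dot g)))
    where
    nonzero : ∀ l → l ≢ 0 → arcCost ins l j ≡ f j + c j * ⟦ l ⟧
    nonzero zero    l≢0 = contradiction refl l≢0
    nonzero (suc l) _   = cong (f j +_) (*-comm ⟦ suc l ⟧ (c j))

module ArcFlowGraph (ins : Instance)
                    (w-distinct : ∀ d d′ → Instance.w ins d ≡ Instance.w ins d′ → d ≡ d′) where
  open Instance ins

  arc : ℕ × Fin n' → ℕ × ℕ
  arc (a , d) = (a , a ℕ.+ w d)

  _≟ₐ_ : DecidableEquality (ℕ × ℕ)
  _≟ₐ_ = ProdP.≡-dec _≟_ _≟_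

  C≤Cmax : ∀ j → C j ℕ.≤ Cmax ins
  C≤Cmax j = bound (map C (allFin m)) (∈-map⁺ C (∈-allFin j))
    where
    bound : ∀ {x} (L : List ℕ) → x ∈ L → x ℕ.≤ foldr ℕ._⊔_ 0 L
    bound (y ∷ L) (here refl) = ℕP.m≤m⊔n y _
    bound (y ∷ L) (there i)   = ℕP.≤-trans (bound L i) (ℕP.m≤n⊔m y _)

  -- The arc of item d at node a, if it fits below C_max, lies in the block
  -- of arcs of size w d exactly once, and in no other block since the sizes
  -- are distinct.
  arcsOf-point : ∀ a d d′ (h : ℕ × ℕ → ℚ) → a ℕ.+ w d ℕ.≤ Cmax ins →
    ∑ (arcsOf ins d′) (λ e → 𝟙 (arc (a , d) ≟ₐ e) * h e) ≡ 𝟙 (d FinP.≟ d′) * h (arc (a , d))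
  arcsOf-point a d d′ h fits with d FinP.≟ d′
  ... | yes refl = trans (∑-point _≟ₐ_ h unique member) (sym (*-identityˡ _))
    where
    fits? : Decidable (λ a′ → a′ ℕ.+ w d ℕ.≤ Cmax ins)
    fits? a′ = a′ ℕ.+ w d ≤? Cmax ins
    unique : Unique (arcsOf ins d)
    unique = Unique.map⁺ (cong proj₁) (Unique.filter⁺ fits? (Unique.upTo⁺ (suc (Cmax ins))))
    member : arc (a , d) ∈ arcsOf ins d
    member = ∈-map⁺ _ (∈-filter⁺ fits? (∈-upTo⁺ (ℕ.s≤s (ℕP.m+n≤o⇒m≤o a fits))) fits)
  ... | no d≢d′ = trans (∑-vanish (arcsOf ins d′) _ off) (sym (*-zeroˡ (h (arc (a , d)))))
    where
    sameSize : ∀ {a′} → arc (a , d) ≡ (a′ , a′ ℕ.+ w d′) → d ≡ d′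
    sameSize eq = w-distinct d d′
      (ℕP.+-cancelˡ-≡ a _ _ (trans (cong proj₂ eq) (cong (ℕ._+ w d′) (sym (cong proj₁ eq)))))
    off : ∀ {e} → e ∈ arcsOf ins d′ → 𝟙 (arc (a , d) ≟ₐ e) * h e ≡ 0ℚ
    off e∈ with ∈-map⁻ _ e∈
    ... | a′ , _ , refl = trans (cong (_* h (a′ , a′ ℕ.+ w d′)) (𝟙-no (arc (a , d) ≟ₐ (a′ , a′ ℕ.+ w d′)) (d≢d′ ∘ sameSize)))
                                (*-zeroˡ (h (a′ , a′ ℕ.+ w d′)))

  arcs-point : ∀ a d (h : ℕ × ℕ → ℚ) → a ℕ.+ w d ℕ.≤ Cmax ins →
    ∑ (arcs ins) (λ e → 𝟙 (arc (a , d) ≟ₐ e) * h e) ≡ h (arc (a , d))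
  arcs-point a d h fits = begin
    ∑ (arcs ins) (λ e → 𝟙 (arc (a , d) ≟ₐ e) * h e)
      ≡⟨ ∑-concatMap (arcsOf ins) (allFin n') _ ⟩
    ∑ (allFin n') (λ d′ → ∑ (arcsOf ins d′) (λ e → 𝟙 (arc (a , d) ≟ₐ e) * h e))
      ≡⟨ ∑-cong (allFin n') (λ d′ → arcsOf-point a d d′ h fits) ⟩
    ∑ (allFin n') (λ d′ → 𝟙 (d FinP.≟ d′) * h (arc (a , d)))
      ≡⟨ ∑-point FinP._≟_ (λ _ → h (arc (a , d))) (Unique.allFin⁺ n') (∈-allFin d) ⟩
    h (arc (a , d)) ∎

  arcs-filter-point : {P : Pred (ℕ × ℕ) _} (P? : Decidable P) → ∀ a d → a ℕ.+ w d ℕ.≤ Cmax ins →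
    ∑ (filter P? (arcs ins)) (λ e → 𝟙 (arc (a , d) ≟ₐ e)) ≡ 𝟙 (P? (arc (a , d)))
  arcs-filter-point P? a d fits = begin
    ∑ (filter P? (arcs ins)) (λ e → 𝟙 (arc (a , d) ≟ₐ e))
      ≡⟨ ∑-filter P? (arcs ins) _ ⟩
    ∑ (arcs ins) (λ e → 𝟙 (P? e) * 𝟙 (arc (a , d) ≟ₐ e))
      ≡⟨ ∑-cong (arcs ins) (λ e → *-comm (𝟙 (P? e)) _) ⟩
    ∑ (arcs ins) (λ e → 𝟙 (arc (a , d) ≟ₐ e) * 𝟙 (P? e))
      ≡⟨ arcs-point a d (𝟙 ∘ P?) fits ⟩
    𝟙 (P? (arc (a , d))) ∎

module Translation (ins : Instance) (vi : ValidInstance ins)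
                   (p : Sol2 ins) (feasible : Feasible2 ins p) where
  open Instance ins
  open ValidInstance vi using (w-pos; w-distinct)
  open Feasible2 feasible
  open ItemPaths w
  open Patterns ins
  open ArcFlowGraph ins w-distinct

  weighted : (Fin m → Vec ℕ n' → ℚ) → ℚ
  weighted F = ∑ (allFin m) (λ j → ∑ (patterns ins j) (λ g → p j g * F j g))

  weighted-+ : ∀ F G → weighted F + weighted G ≡ weighted (λ j g → F j g + G j g)
  weighted-+ F G = trans (sym (∑-distrib-+ (allFin m) _ _)) (∑-cong (allFin m) λ j →
    trans (sym (∑-distrib-+ (patterns ins j) _ _)) (∑-cong (patterns ins j) λ g →
      sym (*-distribˡ-+ (p j g) (F j g) (G j g))))

  weighted-cong : ∀ {F G} → (∀ j g → g ∈ patterns ins j → F j g ≡ G j g) → weighted F ≡ weighted G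
  weighted-cong eq = ∑-cong (allFin m) λ j → ∑-cong∈ (patterns ins j) λ {g} g∈ → cong (p j g *_) (eq j g g∈)

  weighted-nonneg : ∀ F → (∀ j g → g ∈ patterns ins j → 0ℚ ≤ F j g) → 0ℚ ≤ weighted F
  weighted-nonneg F h = ∑-nonneg (allFin m) _ λ {j} _ → ∑-nonneg (patterns ins j) _ λ {g} g∈ →
    *-nonneg (nonneg j g g∈) (h j g g∈)

  ∑-weighted : {A : Set} (L : List A) (F : A → Fin m → Vec ℕ n' → ℚ) →
               ∑ L (λ e → weighted (F e)) ≡ weighted (λ j g → ∑ L (λ e → F e j g))
  ∑-weighted L F = trans (∑-swap L (allFin m) _) (∑-cong (allFin m) λ j →
    trans (∑-swap L (patterns ins j) _) (∑-cong (patterns ins j) λ g →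
      ∑-scale L (p j g) (λ e → F e j g)))

  load≤C : ∀ {j g} → g ∈ patterns ins j → load ins g ℕ.≤ C j
  load≤C {j} g∈ = proj₂ (∈-filter⁻ (λ g → load ins g ≤? C j) {xs = allBounded n' q} g∈)

  route-fits : ∀ {j g ad} → g ∈ patterns ins j → ad ∈ route g → end ad ℕ.≤ Cmax ins
  route-fits {j} {g} g∈ ad∈ = ℕP.≤-trans (path-bounded 0 (items g) ad∈)
    (ℕP.≤-trans (ℕP.≤-reflexive (size-items g)) (ℕP.≤-trans (load≤C g∈) (C≤Cmax j)))

  uses : Vec ℕ n' → ℕ × ℕ → ℚ
  uses g e = ∑ (route g) (λ ad → 𝟙 (arc ad ≟ₐ e))

  uses-nonneg : ∀ g e → 0ℚ ≤ uses g e
  uses-nonneg g e = ∑-nonneg (route g) _ λ {ad} _ → 𝟙-nonneg (arc ad ≟ₐ e)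

  x : ℕ → ℕ → ℚ
  x a b = weighted (λ _ g → uses g (a , b))

  y : ℕ → Fin m → ℚ
  y a j = ∑ (patterns ins j) (λ g → p j g * 𝟙 (load ins g ≟ a))

  solution : Sol3 ins
  solution = record { x = x ; y = y }

  X : ℕ × ℕ → ℚ
  X e = x (proj₁ e) (proj₂ e)

  uses-filter : ∀ {j g} → g ∈ patterns ins j → {P : Pred (ℕ × ℕ) _} (P? : Decidable P) →
                ∑ (filter P? (arcs ins)) (uses g) ≡ ∑ (route g) (λ ad → 𝟙 (P? (arc ad)))
  uses-filter {g = g} g∈ P? = trans (∑-swap (filter P? (arcs ins)) (route g) _)
    (∑-cong∈ (route g) λ {ad} ad∈ → arcs-filter-point P? (proj₁ ad) (proj₂ ad) (route-fits g∈ ad∈))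

  uses-of-size : ∀ {j g} → g ∈ patterns ins j → ∀ d′ → ∑ (arcsOf ins d′) (uses g) ≡ ⟦ lookup g d′ ⟧
  uses-of-size {g = g} g∈ d′ = begin
    ∑ (arcsOf ins d′) (uses g)
      ≡⟨ ∑-swap (arcsOf ins d′) (route g) _ ⟩
    ∑ (route g) (λ ad → ∑ (arcsOf ins d′) (λ e → 𝟙 (arc ad ≟ₐ e)))
      ≡⟨ ∑-cong∈ (route g) (λ {ad} ad∈ → once ad (route-fits g∈ ad∈)) ⟩
    ∑ (route g) (λ ad → 𝟙 (proj₂ ad FinP.≟ d′))
      ≡⟨ path-items 0 (items g) (λ d → 𝟙 (d FinP.≟ d′)) ⟩
    ∑ (items g) (λ d → 𝟙 (d FinP.≟ d′))
      ≡⟨ count-items g d′ ⟩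
    ⟦ lookup g d′ ⟧ ∎
    where
    once : ∀ ad → end ad ℕ.≤ Cmax ins → ∑ (arcsOf ins d′) (λ e → 𝟙 (arc ad ≟ₐ e)) ≡ 𝟙 (proj₂ ad FinP.≟ d′)
    once (a , d) fits = begin
      ∑ (arcsOf ins d′) (λ e → 𝟙 (arc (a , d) ≟ₐ e))
        ≡⟨ ∑-cong (arcsOf ins d′) (λ e → sym (*-identityʳ _)) ⟩
      ∑ (arcsOf ins d′) (λ e → 𝟙 (arc (a , d) ≟ₐ e) * 1ℚ)
        ≡⟨ arcsOf-point a d d′ (λ _ → 1ℚ) fits ⟩
      𝟙 (d FinP.≟ d′) * 1ℚ ≡⟨ *-identityʳ _ ⟩
      𝟙 (d FinP.≟ d′) ∎

  pattern-conservation : ∀ {j g} → g ∈ patterns ins j → ∀ b →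
    ∑ (arcsInto ins b) (uses g) + 𝟙 (0 ≟ b) ≡ ∑ (arcsOutOf ins b) (uses g) + 𝟙 (load ins g ≟ b)
  pattern-conservation {g = g} g∈ b = begin
    ∑ (arcsInto ins b) (uses g) + 𝟙 (0 ≟ b)
      ≡⟨ cong (_+ 𝟙 (0 ≟ b)) (uses-filter g∈ (λ e → proj₂ e ≟ b)) ⟩
    ∑ (route g) (λ ad → 𝟙 (end ad ≟ b)) + 𝟙 (0 ≟ b)
      ≡⟨ path-conservation 0 (items g) b ⟩
    ∑ (route g) (λ ad → 𝟙 (proj₁ ad ≟ b)) + 𝟙 (size (items g) ≟ b)
      ≡⟨ cong₂ _+_ (sym (uses-filter g∈ (λ e → proj₁ e ≟ b))) (cong (λ l → 𝟙 (l ≟ b)) (size-items g)) ⟩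
    ∑ (arcsOutOf ins b) (uses g) + 𝟙 (load ins g ≟ b) ∎

  pattern-source : ∀ {j g} → g ∈ patterns ins j → ∑ (arcsInto ins 0) (uses g) ≡ 0ℚ
  pattern-source {g = g} g∈ = trans (uses-filter g∈ (λ e → proj₂ e ≟ 0)) (path-source w-pos 0 (items g))

  ∑-y : ∀ j K (h : ℕ → ℚ) → (∀ {g} → g ∈ patterns ins j → load ins g ℕ.< K) →
        ∑ (upTo K) (λ a → h a * y a j) ≡ ∑ (patterns ins j) (λ g → h (load ins g) * p j g)
  ∑-y j K h below = begin
    ∑ (upTo K) (λ a → h a * ∑ (patterns ins j) (λ g → p j g * 𝟙 (load ins g ≟ a)))
      ≡⟨ ∑-cong (upTo K) (λ a → sym (∑-scale (patterns ins j) (h a) _)) ⟩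
    ∑ (upTo K) (λ a → ∑ (patterns ins j) (λ g → h a * (p j g * 𝟙 (load ins g ≟ a))))
      ≡⟨ ∑-swap (upTo K) (patterns ins j) _ ⟩
    ∑ (patterns ins j) (λ g → ∑ (upTo K) (λ a → h a * (p j g * 𝟙 (load ins g ≟ a))))
      ≡⟨ ∑-cong∈ (patterns ins j) (λ {g} g∈ → trans (∑-cong (upTo K) (λ a → reorder (h a) (p j g) _))
                                       (∑-point _≟_ (λ a → h a * p j g) (Unique.upTo⁺ K) (∈-upTo⁺ (below g∈)))) ⟩
    ∑ (patterns ins j) (λ g → h (load ins g) * p j g) ∎
    where
    reorder : ∀ u v i → u * (v * i) ≡ i * (u * v)
    reorder = solve 3 (λ u v i → u :* (v :* i) := i :* (u :* v)) refl

  flow : ∀ b → 1 ℕ.≤ b → (∑ (arcsInto ins b) X - ∑ (arcsOutOf ins b) X) - ΣFinℚ m (y b) ≡ 0ℚ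
  flow b 1≤b = begin
    (∑ (arcsInto ins b) X - Out) - Y
      ≡⟨ cong (λ t → (t - Out) - Y) inflow ⟩
    ((Out + Y) - Out) - Y
      ≡⟨ solve 2 (λ o u → ((o :+ u) :- o) :- u := con 0ℚ) refl Out Y ⟩
    0ℚ ∎
    where
    Out Y : ℚ
    Out = ∑ (arcsOutOf ins b) X
    Y   = ΣFinℚ m (y b)
    inflow : ∑ (arcsInto ins b) X ≡ Out + Y
    inflow = begin
      ∑ (arcsInto ins b) X
        ≡⟨ ∑-weighted (arcsInto ins b) _ ⟩
      weighted (λ _ g → ∑ (arcsInto ins b) (uses g))
        ≡⟨ weighted-cong (λ j g g∈ → trans (sym (+-identityʳ _)) (trans
              (cong (∑ (arcsInto ins b) (uses g) +_) (sym (𝟙-no (0 ≟ b) (ℕP.<⇒≢ 1≤b))))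
              (pattern-conservation g∈ b))) ⟩
      weighted (λ _ g → ∑ (arcsOutOf ins b) (uses g) + 𝟙 (load ins g ≟ b))
        ≡⟨ sym (weighted-+ _ _) ⟩
      weighted (λ _ g → ∑ (arcsOutOf ins b) (uses g)) + Y
        ≡⟨ cong (_+ Y) (sym (∑-weighted (arcsOutOf ins b) _)) ⟩
      Out + Y ∎

  flow0 : (- ∑ (arcsOutOf ins 0) X) - ΣFinℚ m (y 0) ≡ - ⟦ m ⟧
  flow0 = trans (sym (neg-distrib-+ (∑ (arcsOutOf ins 0) X) (ΣFinℚ m (y 0)))) (cong -_ outflow)
    where
    outflow : ∑ (arcsOutOf ins 0) X + ΣFinℚ m (y 0) ≡ ⟦ m ⟧
    outflow = begin
      ∑ (arcsOutOf ins 0) X + ΣFinℚ m (y 0)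
        ≡⟨ cong (_+ ΣFinℚ m (y 0)) (∑-weighted (arcsOutOf ins 0) _) ⟩
      weighted (λ _ g → ∑ (arcsOutOf ins 0) (uses g)) + ΣFinℚ m (y 0)
        ≡⟨ weighted-+ _ _ ⟩
      weighted (λ _ g → ∑ (arcsOutOf ins 0) (uses g) + 𝟙 (load ins g ≟ 0))
        ≡⟨ weighted-cong (λ j g g∈ → trans (sym (pattern-conservation g∈ 0))
                                            (cong (_+ 1ℚ) (pattern-source g∈))) ⟩
      weighted (λ _ _ → 0ℚ + 1ℚ)
        ≡⟨ ∑-cong (allFin m) (λ j → trans (∑-cong (patterns ins j) (λ g → *-identityʳ (p j g))) (convex j)) ⟩
      ∑ (allFin m) (λ _ → 1ℚ)
        ≡⟨ trans (∑-length (allFin m)) (cong ⟦_⟧ (ListP.length-tabulate {n = m} (λ i → i))) ⟩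
      ⟦ m ⟧ ∎

  assign : ∀ j → Σ≤ℚ (C j) (λ a → y a j) ≡ 1ℚ
  assign j = begin
    ∑ (upTo (suc (C j))) (λ a → y a j)
      ≡⟨ ∑-cong (upTo (suc (C j))) (λ a → sym (*-identityˡ (y a j))) ⟩
    ∑ (upTo (suc (C j))) (λ a → 1ℚ * y a j)
      ≡⟨ ∑-y j (suc (C j)) (λ _ → 1ℚ) (ℕ.s≤s ∘ load≤C) ⟩
    ∑ (patterns ins j) (λ g → 1ℚ * p j g)
      ≡⟨ trans (∑-cong (patterns ins j) (λ g → *-identityˡ (p j g))) (convex j) ⟩
    1ℚ ∎

  y-le1 : ∀ a j → y a j ≤ 1ℚ
  y-le1 a j = ≤-trans
    (∑-mono (patterns ins j) _ (p j) λ {g} g∈ →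
      ≤-trans (*-monoˡ-≤-nonNeg (p j g) {{nonNegative (nonneg j g g∈)}} (𝟙≤1 (load ins g ≟ a)))
              (≤-reflexive (*-identityʳ (p j g))))
    (≤-reflexive (convex j))

  y-zero : ∀ j a → C j ℕ.< a → y a j ≡ 0ℚ
  y-zero j a C<a = ∑-vanish (patterns ins j) _ λ {g} g∈ →
    trans (cong (p j g *_) (𝟙-no (load ins g ≟ a) (λ eq → ℕP.<⇒≢ (ℕP.≤-<-trans (load≤C g∈) C<a) eq)))
          (*-zeroʳ (p j g))

  translation-feasible : Feasible3 ins solution
  translation-feasible = record
    { x-nonneg = λ a b _ → weighted-nonneg _ (λ _ g _ → uses-nonneg g (a , b))
    ; y-nonneg = λ a j _ → ∑-nonneg (patterns ins j) _ λ {g} g∈ →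
                   *-nonneg (nonneg j g g∈) (𝟙-nonneg (load ins g ≟ a))
    ; y-le1    = λ a j _ → y-le1 a j
    ; flow     = λ b 1≤b _ → flow b 1≤b
    ; flow0    = flow0
    ; assign   = assign
    ; demand   = λ d′ → begin
        ∑ (arcsOf ins d′) X
          ≡⟨ ∑-weighted (arcsOf ins d′) _ ⟩
        weighted (λ _ g → ∑ (arcsOf ins d′) (uses g))
          ≡⟨ weighted-cong (λ j g g∈ → uses-of-size g∈ d′) ⟩
        weighted (λ _ g → ⟦ lookup g d′ ⟧)
          ≡⟨ ∑-cong (allFin m) (λ j → ∑-cong (patterns ins j) (λ g → *-comm (p j g) _)) ⟩
        _ ≡⟨ demand d′ ⟩
        ⟦ q d′ ⟧ ∎
    ; y-zero   = λ j a C<a _ → y-zero j a C<a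
    }

  translation-cost : obj3 ins solution ≡ obj2 ins p
  translation-cost = ∑-cong (allFin m) λ j → trans
    (∑-y j (suc (Cmax ins)) (λ a → arcCost ins a j) (λ g∈ → ℕ.s≤s (ℕP.≤-trans (load≤C g∈) (C≤Cmax j))))
    (∑-cong (patterns ins j) λ g → cong (_* p j g) (arcCost≡patCost w-pos j g))

proposition3 : (ins : Instance) → ValidInstance ins →
    (z₂ z₃ : ℚ) → IsOptimalValue2 ins z₂ → IsOptimalValue3 ins z₃ → z₃ ≤ z₂
proposition3 ins vi z₂ z₃ ((p , feasible , obj₂≡z₂) , _) (_ , z₃-lower-bound) =
  ≤-trans (z₃-lower-bound solution translation-feasible)
          (≤-reflexive (trans translation-cost obj₂≡z₂))
  where open Translation ins vi p feasible
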